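{- There exist infinitely many cyclic $(n_3)$ configurations that are splittable. In particular, the following cyclic Haar graphs are splittable: (a) $H(n,\{0,1,4\})$ for every $n\ge 13$; (b) $H(n,\{0,1,5\})$ for every $n\ge 16$; (c) $H(n,\{0,2,5\})$ for every $n\ge 16$. Moreover, each of these graphs has girth 6, and so is the Levi graph of a cyclic $(n_3)$ configuration.
   Context: For a positive integer $n$ and $S\subseteq\mathbb{Z}_n$, the cyclic Haar graph $H(n,S)$ has vertex set $\{i^+: i\in\mathbb{Z}_n\}\cup\{i^-: i\in\mathbb{Z}_n\}$. Its edges join $i^+$ to $(i+k)^-$ for each $i\in\mathbb{Z}_n$ and each $k\in S$. A combinatorial $(n_3)$ configuration consists of $n$ points and $n$ lines with an incidence relation such that: - each line is incident with 3 points; - each point is incident with 3 lines; - two distinct points lie on at most one common line. Its Levi graph is the bipartite point–line incidence graph. A configuration is cyclic if it has an automorphism of order $n$ cyclically permuting the points and cyclically permuting the lines. Equivalently, its Levi graph is isomorphic to a cyclic Haar graph of girth 6, with the $i^+$ vertices as points and the $i^-$ vertices as lines. The square $G^2$ of a graph $G$ joins two distinct vertices iff their distance in $G$ is at most 2. A connected graph $G$ is splittable if some $\Sigma\subseteq V(G)$ is independent in $G^2$ and $G-\Sigma$ is disconnected. A configuration is splittable if its Levi graph is splittable. -}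

module Defs where

open import Data.Nat using (ℕ; zero; suc; _+_; _*_; _≤_; _<_)
open import Data.Fin using (Fin; toℕ; inject₁; fromℕ) renaming (zero to fzero; suc to fsuc)
open import Data.Sum using (_⊎_; inj₁; inj₂)
open import Data.Product using (Σ; ∃; ∃-syntax; _×_; _,_)
open import Data.List using (List)
open import Data.List.Membership.Propositional using (_∈_)
open import Data.Bool using (Bool; true; false)
open import Data.Empty using (⊥)
open import Relation.Binary.PropositionalEquality using (_≡_; _≢_)
open import Relation.Nullary using (¬_)
open import Function.Definitions using (Injective)

record Graph : Set₁ where
  field
    V   : Set
    Adj : V → V → Set

module _ (G : Graph) where
  open Graph G

  data WalkIn (ok : V → Bool) : V → V → Set where
    here : ∀ {u} → ok u ≡ true → WalkIn ok u u
    step : ∀ {u w v} → ok u ≡ true → Adj u w → WalkIn ok w v → WalkIn ok u v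

  Connected : Set
  Connected = ∀ u v → WalkIn (λ _ → true) u v

  DisconnectedAfterRemoving : (V → Bool) → Set
  DisconnectedAfterRemoving Σs =
    ∃[ u ] ∃[ v ] (Σs u ≡ false × Σs v ≡ false × ¬ WalkIn (λ x → Data.Bool.not (Σs x)) u v)

  Adj² : V → V → Set
  Adj² u v = u ≢ v × (Adj u v ⊎ ∃[ w ] (Adj u w × Adj w v))

  IndependentIn² : (V → Bool) → Set
  IndependentIn² Σs = ∀ u v → Σs u ≡ true → Σs v ≡ true → ¬ Adj² u v

  Splittable : Set
  Splittable = Connected × ∃[ Σs ] (IndependentIn² Σs × DisconnectedAfterRemoving Σs)

  -- A cycle of length k (k ≥ 3): k pairwise distinct vertices f 0, …, f (k-1)
  -- with f i adjacent to f (i+1) and f (k-1) adjacent to f 0.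
  CycleOfLength : ℕ → Set
  CycleOfLength zero = ⊥
  CycleOfLength (suc m) =
    2 ≤ m × ∃[ f ] (Injective _≡_ _≡_ f
      × (∀ (i : Fin m) → Adj (f (inject₁ i)) (f (fsuc i)))
      × Adj (f (fromℕ m)) (f fzero))

  HasGirth : ℕ → Set
  HasGirth g = CycleOfLength g × (∀ k → k < g → ¬ CycleOfLength k)

-- Vertices: inj₁ i = i⁺, inj₂ i = i⁻ (i ∈ ℤ_n ≅ Fin n).
-- i⁺ ~ j⁻ iff j ≡ i + k (mod n) for some k ∈ S, i.e. i + k = j + q n for some q
-- (valid since j < n and i + k ≥ 0).

HaarEdge : (n : ℕ) → List ℕ → Fin n → Fin n → Set
HaarEdge n S i j = ∃[ k ] (k ∈ S × ∃[ q ] (toℕ i + k ≡ toℕ j + q * n))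

HaarAdj : (n : ℕ) → List ℕ → Fin n ⊎ Fin n → Fin n ⊎ Fin n → Set
HaarAdj n S (inj₁ i) (inj₁ j) = ⊥
HaarAdj n S (inj₁ i) (inj₂ j) = HaarEdge n S i j
HaarAdj n S (inj₂ j) (inj₁ i) = HaarEdge n S i j
HaarAdj n S (inj₂ i) (inj₂ j) = ⊥

H : (n : ℕ) → List ℕ → Graph
H n S = record { V = Fin n ⊎ Fin n ; Adj = HaarAdj n S }

module Submission where

-- Every step is reduced to
-- arithmetic of congruences modulo n: an edge i⁺ ~ j⁻ says i + k ≡ j (mod n)
-- for some k ∈ S, and as long as all numbers involved stay below n such a
-- congruence is an equality of natural numbers.
--
-- * Girth 6 (for any S ∋ 0 < a < b with k + k' < n for k, k' ∈ S):
--   H(n,S) is bipartite, so it has no 3- or 5-cycles; it has no 4-cycles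
--   when S is a Sidon set (sums of two elements determine the summands);
--   0⁺ b⁻ b⁺ (a+b)⁻ a⁺ a⁻ is a 6-cycle.
-- * Connectivity: if 0, d ∈ S then x⁺ and (x+d)⁺ share the neighbour
--   (x+d)⁻, so every x⁺ reaches some r⁺ with r < d; it remains to join
--   those finitely many vertices to 0⁺.
-- * Splitting: a finite certificate (a set Σ = Σ⁺ ∪ Σ⁻ and a set
--   C = C⁺ ∪ C⁻ of small labels) whose neighbourhood conditions are checked
--   by a decision procedure; it shows that Σ is independent in G² and that
--   C ∖ Σ is closed under walks in G - Σ, while some vertex outside C ∪ Σ
--   exists.  The conditions only involve numbers below a bound N, so one
--   certificate works for every n ≥ N.

open import Defs
open import Data.Nat using (ℕ; zero; suc; _+_; _*_; _∸_; _≤_; _<_; z<s; s<s; s≤s; z≤n; _≟_; _≤?_; _<?_; NonZero)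
open import Data.Nat.Properties
open import Algebra.Properties.CommutativeSemigroup +-commutativeSemigroup using (interchange; x∙yz≈y∙xz; xy∙z≈xz∙y)
open import Data.Nat.DivMod using (_%_; _/_; m≡m%n+[m/n]*n; m%n<n)
open import Data.Nat.Tactic.RingSolver using (solve-∀)
open import Data.Fin using (Fin; toℕ; fromℕ<; inject₁; fromℕ; #_) renaming (zero to fzero; suc to fsuc)
open import Data.Fin.Properties using (toℕ-injective; toℕ<n; toℕ-fromℕ<; fromℕ<-toℕ)
open import Data.List using (List; _∷_; [])
open import Data.List.Membership.Propositional using (_∈_; _∉_)
open import Data.List.Membership.DecPropositional _≟_ using (_∈?_)
open import Data.List.Relation.Unary.All as All using (All; all?)
open import Data.List.Relation.Unary.Any using (here; there)
open import Data.Vec using (Vec; lookup; _∷_; [])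
open import Data.Vec.Relation.Unary.All using ([]; _∷_)
open import Data.Vec.Relation.Unary.AllPairs using ([]; _∷_)
open import Data.Vec.Relation.Unary.Unique.Propositional using (Unique)
open import Data.Vec.Relation.Unary.Unique.Propositional.Properties using (lookup-injective)
open import Data.Sum using (_⊎_; inj₁; inj₂) renaming (map to map-⊎)
open import Data.Product using (∃₂; _×_; _,_; proj₁; proj₂)
open import Data.Bool using (Bool; true; false; not)
open import Data.Bool.Properties using (not-¬)
open import Data.Empty using (⊥; ⊥-elim)
open import Relation.Nullary using (¬_; Dec; yes; no; does)
open import Relation.Nullary.Decidable using (dec-true; dec-false; from-yes; map′; _×-dec_; _⊎-dec_; _→-dec_; ¬?)
open import Relation.Binary.PropositionalEquality
open import Function using (_∘_)

does-true : ∀ {P : Set} (p? : Dec P) → does p? ≡ true → P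
does-true (yes p) _ = p
does-true (no _) ()

All² : (ℕ → ℕ → Set) → List ℕ → List ℕ → Set
All² P xs ys = All (λ x → All (P x) ys) xs

all²? : ∀ {P : ℕ → ℕ → Set} → (∀ x y → Dec (P x y)) → ∀ xs ys → Dec (All² P xs ys)
all²? P? xs ys = all? (λ x → all? (P? x) ys) xs

lookup² : ∀ {P : ℕ → ℕ → Set} {xs ys x y} → All² P xs ys → x ∈ xs → y ∈ ys → P x y
lookup² table x∈ y∈ = All.lookup (All.lookup table x∈) y∈

regroup-multiples : ∀ a b c d n → (a + b * n) + (c + d * n) ≡ (a + c) + (b + d) * n
regroup-multiples = solve-∀

-- The ring identity behind one step of descent by d (with difference 0 ∈ S).
one-step-down : ∀ d m r → d + m + r + 0 ≡ m + r + d
one-step-down = solve-∀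

Sidon : List ℕ → Set
Sidon S = All² (λ k₁ k₂ → All² (λ k₃ k₄ →
  k₁ + k₃ ≡ k₂ + k₄ → (k₁ ≡ k₂ × k₃ ≡ k₄) ⊎ (k₁ ≡ k₄ × k₃ ≡ k₂)) S S) S S

sidon? : ∀ S → Dec (Sidon S)
sidon? S = all²? (λ k₁ k₂ → all²? (λ k₃ k₄ →
  (k₁ + k₃ ≟ k₂ + k₄) →-dec (((k₁ ≟ k₂) ×-dec (k₃ ≟ k₄)) ⊎-dec ((k₁ ≟ k₄) ×-dec (k₃ ≟ k₂)))) S S) S S

SumsBelow : ℕ → List ℕ → Set
SumsBelow N S = All² (λ k k′ → k + k′ < N) S S

sums-below? : ∀ N S → Dec (SumsBelow N S)
sums-below? N S = all²? (λ k k′ → k + k′ <? N) S S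

sums-below-mono : ∀ {N n S} → N ≤ n → SumsBelow N S → SumsBelow n S
sums-below-mono N≤n = All.map (All.map (λ k+k′<N → <-≤-trans k+k′<N N≤n))

-- Congruence modulo n, in the additive form used by the edges of H(n,S):
-- x ≈ y when x + p n = y + r n for some p, r.
module Congruence (n : ℕ) where

  infix 4 _≈_
  _≈_ : ℕ → ℕ → Set
  x ≈ y = ∃₂ λ p r → x + p * n ≡ y + r * n

  ≈-from-edge : ∀ {x y} q → x ≡ y + q * n → x ≈ y
  ≈-from-edge q e = 0 , q , trans (+-identityʳ _) e

  ≈-refl : ∀ {x} → x ≈ x
  ≈-refl = 0 , 0 , refl

  ≈-sym : ∀ {x y} → x ≈ y → y ≈ x
  ≈-sym (p , r , e) = r , p , sym e

  ≈-+ : ∀ {x y x′ y′} → x ≈ y → x′ ≈ y′ → x + x′ ≈ y + y′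
  ≈-+ {x} {y} {x′} {y′} (p , r , e) (p′ , r′ , e′) =
    p + p′ , r + r′ , trans (sym (regroup-multiples x p x′ p′ n)) (trans (cong₂ _+_ e e′) (regroup-multiples y r y′ r′ n))

  ≈-cancelˡ : ∀ z {x y} → z + x ≈ z + y → x ≈ y
  ≈-cancelˡ z {x} {y} (p , r , e) =
    p , r , +-cancelˡ-≡ z _ _ (trans (sym (+-assoc z x (p * n))) (trans e (+-assoc z y (r * n))))

  ≈-trans : ∀ {x y z} → x ≈ y → y ≈ z → x ≈ z
  ≈-trans {x} {y} {z} h h′ = ≈-cancelˡ y (subst (_≈ y + z) (+-comm x y) (≈-+ h h′))

  residue-unique : ∀ {x y} p r → x + p * n ≡ y + r * n → x < y + n → y < x + n → x ≡ y
  residue-unique {x} {y} zero zero e _ _ = +-cancelʳ-≡ 0 x y e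
  residue-unique {x} {y} zero (suc r) e x<y+n _ = ⊥-elim (<⇒≱ x<y+n y+n≤x)
    where
      open ≤-Reasoning
      y+n≤x : y + n ≤ x
      y+n≤x = begin
        y + n           ≤⟨ +-monoʳ-≤ y (m≤m+n n (r * n)) ⟩
        y + (n + r * n) ≡⟨ sym e ⟩
        x + 0           ≡⟨ +-identityʳ x ⟩
        x               ∎
  residue-unique (suc p) zero e x<y+n y<x+n = sym (residue-unique zero (suc p) (sym e) y<x+n x<y+n)
  residue-unique {x} {y} (suc p) (suc r) e = residue-unique p r (+-cancelˡ-≡ n _ _ e′)
    where
      e′ : n + (x + p * n) ≡ n + (y + r * n)
      e′ = trans (sym (x∙yz≈y∙xz x n (p * n))) (trans e (x∙yz≈y∙xz y n (r * n)))

  ≈-exact : ∀ {x y} → x ≈ y → x < y + n → y < x + n → x ≡ y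
  ≈-exact (p , r , e) = residue-unique p r e

  ≈-below : ∀ {x y} → x ≈ y → x < n → y < n → x ≡ y
  ≈-below {x} {y} h x<n y<n = ≈-exact h (<-≤-trans x<n (m≤n+m n y)) (<-≤-trans y<n (m≤n+m n x))

-- A splitting certificate for H(n,S): the labels of the two halves of
-- Σ = Σ⁺ ∪ Σ⁻, of a vertex set C = C⁺ ∪ C⁻ meant to contain a component of
-- G - Σ, and of two plus-vertices, one inside C ∖ Σ and one outside C ∪ Σ.
record SplitCertificate : Set where
  constructor certificate
  field
    C⁺ C⁻ Σ⁺ Σ⁻ : List ℕ
    inside outside : ℕ

-- The conditions making a certificate work for every n ≥ N.  All sums that
-- occur stay below N, so congruences mod n between them are equalities.
record ValidCertificate (S : List ℕ) (N : ℕ) (cert : SplitCertificate) : Set where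
  open SplitCertificate cert
  field
    -- every neighbour (c + k)⁻ of a vertex c⁺ ∈ C lies in C ∪ Σ
    plus-closed : All (λ c → All (λ k → c + k < N × (c + k ∈ C⁻ ⊎ c + k ∈ Σ⁻)) S) C⁺
    -- every neighbour (c - k)⁺ of a vertex c⁻ ∈ C lies in C ∪ Σ
    minus-closed : All (λ c → All (λ k → k ≤ c × c < N × (c ∸ k ∈ C⁺ ⊎ c ∸ k ∈ Σ⁺)) S) C⁻
    -- distinct a⁺, b⁺ ∈ Σ have no common neighbour (a + k₁)⁻ = (b + k₂)⁻
    plus-separated : All² (λ a b → All² (λ k₁ k₂ → a + k₁ < N × (a + k₁ ≡ b + k₂ → a ≡ b)) S S) Σ⁺ Σ⁺
    -- distinct a⁻, b⁻ ∈ Σ have no common neighbour (a - k₁)⁺ = (b - k₂)⁺,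
    -- i.e. a + k₂ = b + k₁ (mod n) forces a = b
    minus-separated : All² (λ a b → All² (λ k₁ k₂ → a + k₂ < b + k₁ + N × (a + k₂ ≡ b + k₁ → a ≡ b)) S S) Σ⁻ Σ⁻
    -- no a⁺ ∈ Σ is adjacent to some b⁻ ∈ Σ
    cross-separated : All² (λ a b → All (λ k → a + k < N × b < N × a + k ≢ b) S) Σ⁺ Σ⁻
    inside∈C⁺ : inside ∈ C⁺
    inside∉Σ⁺ : inside ∉ Σ⁺
    outside∉C⁺ : outside ∉ C⁺
    outside∉Σ⁺ : outside ∉ Σ⁺
    inside<N : inside < N
    outside<N : outside < N

valid? : ∀ S N cert → Dec (ValidCertificate S N cert)
valid? S N cert@(certificate C⁺ C⁻ Σ⁺ Σ⁻ inside outside) =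
  map′ (λ (p₁ , p₂ , p₃ , p₄ , p₅ , p₆ , p₇ , p₈ , p₉ , p₁₀ , p₁₁) → record
         { plus-closed = p₁ ; minus-closed = p₂ ; plus-separated = p₃ ; minus-separated = p₄
         ; cross-separated = p₅ ; inside∈C⁺ = p₆ ; inside∉Σ⁺ = p₇ ; outside∉C⁺ = p₈ ; outside∉Σ⁺ = p₉
         ; inside<N = p₁₀ ; outside<N = p₁₁ })
       (λ v → let open ValidCertificate v in
         plus-closed , minus-closed , plus-separated , minus-separated , cross-separated ,
         inside∈C⁺ , inside∉Σ⁺ , outside∉C⁺ , outside∉Σ⁺ , inside<N , outside<N)
       ( all? (λ c → all? (λ k → (c + k <? N) ×-dec ((c + k ∈? C⁻) ⊎-dec (c + k ∈? Σ⁻))) S) C⁺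
    ×-dec all? (λ c → all? (λ k → (k ≤? c) ×-dec (c <? N) ×-dec ((c ∸ k ∈? C⁺) ⊎-dec (c ∸ k ∈? Σ⁺))) S) C⁻
    ×-dec all²? (λ a b → all²? (λ k₁ k₂ → (a + k₁ <? N) ×-dec ((a + k₁ ≟ b + k₂) →-dec (a ≟ b))) S S) Σ⁺ Σ⁺
    ×-dec all²? (λ a b → all²? (λ k₁ k₂ → (a + k₂ <? b + k₁ + N) ×-dec ((a + k₂ ≟ b + k₁) →-dec (a ≟ b))) S S) Σ⁻ Σ⁻
    ×-dec all²? (λ a b → all? (λ k → (a + k <? N) ×-dec (b <? N) ×-dec ¬? (a + k ≟ b)) S) Σ⁺ Σ⁻
    ×-dec (inside ∈? C⁺) ×-dec ¬? (inside ∈? Σ⁺) ×-dec ¬? (outside ∈? C⁺) ×-dec ¬? (outside ∈? Σ⁺)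
    ×-dec (inside <? N) ×-dec (outside <? N))

module HaarGraph (n : ℕ) (S : List ℕ) where

  open Congruence n

  V : Set
  V = Fin n ⊎ Fin n

  Adj : V → V → Set
  Adj = HaarAdj n S

  plus minus : (x : ℕ) → .(x < n) → V
  plus x x<n = inj₁ (fromℕ< x<n)
  minus x x<n = inj₂ (fromℕ< x<n)

  label : V → ℕ
  label (inj₁ i) = toℕ i
  label (inj₂ i) = toℕ i

  plus-injective : ∀ {x y} .{x<n : x < n} .{y<n : y < n} → plus x x<n ≡ plus y y<n → x ≡ y
  plus-injective {x<n = x<n} {y<n} e = trans (sym (toℕ-fromℕ< x<n)) (trans (cong label e) (toℕ-fromℕ< y<n))

  minus-injective : ∀ {x y} .{x<n : x < n} .{y<n : y < n} → minus x x<n ≡ minus y y<n → x ≡ y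
  minus-injective {x<n = x<n} {y<n} e = trans (sym (toℕ-fromℕ< x<n)) (trans (cong label e) (toℕ-fromℕ< y<n))

  edge : ∀ {x y k} → k ∈ S → x + k ≡ y → .(x<n : x < n) .(y<n : y < n) →
         HaarEdge n S (fromℕ< x<n) (fromℕ< y<n)
  edge {x} {y} {k} k∈S x+k≡y x<n y<n = k , k∈S , 0 , (begin
    toℕ (fromℕ< x<n) + k ≡⟨ cong (_+ k) (toℕ-fromℕ< x<n) ⟩
    x + k                ≡⟨ x+k≡y ⟩
    y                    ≡⟨ sym (toℕ-fromℕ< y<n) ⟩
    toℕ (fromℕ< y<n)     ≡⟨ sym (+-identityʳ _) ⟩
    toℕ (fromℕ< y<n) + 0 ∎)
    where open ≡-Reasoning

  adj-sym : ∀ {u v} → Adj u v → Adj v u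
  adj-sym {inj₁ _} {inj₂ _} a = a
  adj-sym {inj₂ _} {inj₁ _} a = a

  side : V → Bool
  side (inj₁ _) = true
  side (inj₂ _) = false

  adj-flips-side : ∀ {u v} → Adj u v → side v ≡ not (side u)
  adj-flips-side {inj₁ _} {inj₂ _} _ = refl
  adj-flips-side {inj₂ _} {inj₁ _} _ = refl

  two-steps-keep-side : ∀ {u v w} → Adj u v → Adj v w → side w ≡ side u
  two-steps-keep-side {inj₁ _} {inj₂ _} {inj₁ _} _ _ = refl
  two-steps-keep-side {inj₂ _} {inj₁ _} {inj₂ _} _ _ = refl

  no-3-cycle : ¬ CycleOfLength (H n S) 3
  no-3-cycle (_ , f , _ , path , close) =
    not-¬ refl (trans (adj-flips-side close) (cong not (two-steps-keep-side (path (# 0)) (path (# 1)))))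

  no-5-cycle : ¬ CycleOfLength (H n S) 5
  no-5-cycle (_ , f , _ , path , close) = not-¬ refl (trans (adj-flips-side close) (cong not f4∼f0))
    where
      f4∼f0 : side (f (# 4)) ≡ side (f (# 0))
      f4∼f0 = trans (two-steps-keep-side (path (# 2)) (path (# 3))) (two-steps-keep-side (path (# 0)) (path (# 1)))

  Walk : V → V → Set
  Walk = WalkIn (H n S) (λ _ → true)

  _++_ : ∀ {u v w} → Walk u v → Walk v w → Walk u w
  here _ ++ q = q
  step ok a p ++ q = step ok a (p ++ q)

  reverse : ∀ {u v} → Walk u v → Walk v u
  reverse (here ok) = here ok
  reverse (step _ a p) = reverse p ++ step refl (adj-sym a) (here refl)

  -- A 4-cycle a⁺ b⁻ c⁺ d⁻ via k₁, k₂, k₃, k₄ gives k₁ + k₃ ≈ k₂ + k₄, an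
  -- equality when sums are small; the Sidon property then forces a = c or b = d.
  no-rectangle : Sidon S → SumsBelow n S → ∀ {a b c d : Fin n} → a ≢ c → b ≢ d →
    HaarEdge n S a b → HaarEdge n S c b → HaarEdge n S c d → HaarEdge n S a d → ⊥
  no-rectangle sidon small {a} {b} {c} {d} a≢c b≢d
    (k₁ , k₁∈S , q₁ , e₁) (k₂ , k₂∈S , q₂ , e₂) (k₃ , k₃∈S , q₃ , e₃) (k₄ , k₄∈S , q₄ , e₄) =
    conclude (lookup² (lookup² sidon k₁∈S k₂∈S) k₃∈S k₄∈S sums-equal)
    where
      A C : ℕ
      A = toℕ a
      C = toℕ c
      ab : A + k₁ ≈ toℕ b
      ab = ≈-from-edge q₁ e₁
      cb : C + k₂ ≈ toℕ b
      cb = ≈-from-edge q₂ e₂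
      cd : C + k₃ ≈ toℕ d
      cd = ≈-from-edge q₃ e₃
      ad : A + k₄ ≈ toℕ d
      ad = ≈-from-edge q₄ e₄

      -- (A + C) + (k₁ + k₃) ≈ b + d ≈ (A + C) + (k₂ + k₄)
      sums-≈ : k₁ + k₃ ≈ k₂ + k₄
      sums-≈ = ≈-cancelˡ (A + C) (subst₂ _≈_ (interchange A k₁ C k₃) (trans (interchange C k₂ A k₄) (cong (_+ (k₂ + k₄)) (+-comm C A)))
        (≈-trans (≈-+ ab cd) (≈-sym (≈-+ cb ad))))

      sums-equal : k₁ + k₃ ≡ k₂ + k₄
      sums-equal = ≈-below sums-≈ (lookup² small k₁∈S k₃∈S) (lookup² small k₂∈S k₄∈S)

      conclude : (k₁ ≡ k₂ × k₃ ≡ k₄) ⊎ (k₁ ≡ k₄ × k₃ ≡ k₂) → ⊥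
      conclude (inj₁ (k₁≡k₂ , _)) = a≢c (toℕ-injective (≈-below a≈c (toℕ<n a) (toℕ<n c)))
        where
          a≈c : A ≈ C
          a≈c = ≈-cancelˡ k₁ (subst₂ _≈_ (+-comm A k₁) (trans (cong (C +_) (sym k₁≡k₂)) (+-comm C k₁))
                  (≈-trans ab (≈-sym cb)))
      conclude (inj₂ (k₁≡k₄ , _)) = b≢d (toℕ-injective (≈-below b≈d (toℕ<n b) (toℕ<n d)))
        where
          b≈d : toℕ b ≈ toℕ d
          b≈d = ≈-trans (≈-sym ab) (subst (λ k → A + k ≈ toℕ d) (sym k₁≡k₄) ad)

  no-4-cycle : Sidon S → SumsBelow n S → ¬ CycleOfLength (H n S) 4
  no-4-cycle sidon small (_ , f , f-injective , path , close) =
    square (f (# 0)) (f (# 1)) (f (# 2)) (f (# 3)) (λ e → 0≢2 (f-injective e)) (λ e → 1≢3 (f-injective e))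
      (path (# 0)) (path (# 1)) (path (# 2)) close
    where
      0≢2 : _≢_ {A = Fin 4} (# 0) (# 2)
      0≢2 ()
      1≢3 : _≢_ {A = Fin 4} (# 1) (# 3)
      1≢3 ()
      -- A closed walk of length 4 alternates sides, so it is a⁺ b⁻ c⁺ d⁻ up to rotation.
      square : ∀ u₀ u₁ u₂ u₃ → u₀ ≢ u₂ → u₁ ≢ u₃ → Adj u₀ u₁ → Adj u₁ u₂ → Adj u₂ u₃ → Adj u₃ u₀ → ⊥
      square (inj₁ a) (inj₂ b) (inj₁ c) (inj₂ d) a≢c b≢d ab bc cd da =
        no-rectangle sidon small (λ e → a≢c (cong inj₁ e)) (λ e → b≢d (cong inj₂ e)) ab bc cd da
      square (inj₂ b) (inj₁ a) (inj₂ d) (inj₁ c) b≢d a≢c ba ad dc cb =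
        no-rectangle sidon small (λ e → a≢c (cong inj₁ e)) (λ e → b≢d (cong inj₂ e)) ba cb dc ad
      square (inj₁ _) (inj₁ _) _ _ _ _ () _ _ _
      square (inj₂ _) (inj₂ _) _ _ _ _ () _ _ _
      square (inj₁ _) (inj₂ _) (inj₂ _) _ _ _ _ () _ _
      square (inj₂ _) (inj₁ _) (inj₁ _) _ _ _ _ () _ _
      square (inj₁ _) (inj₂ _) (inj₁ _) (inj₁ _) _ _ _ _ () _
      square (inj₂ _) (inj₁ _) (inj₂ _) (inj₂ _) _ _ _ _ () _

  -- For 0 < a < b in S with a + b < n, the walk 0⁺ b⁻ b⁺ (a+b)⁻ a⁺ a⁻ is a
  -- 6-cycle: it uses the differences b, 0, a, b, 0, a, and its vertices are
  -- distinct because 0, a, b and a, b, a + b are.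
  hexagon : ∀ {a b} → 0 ∈ S → a ∈ S → b ∈ S → 0 < a → a < b → a + b < n → CycleOfLength (H n S) 6
  hexagon {a} {b} 0∈S a∈S b∈S 0<a a<b a+b<n =
    s≤s (s≤s z≤n) , lookup hexagon-vertices , (λ {i} {j} → lookup-injective distinct i j) , path , close
    where
      b<n : b < n
      b<n = ≤-<-trans (m≤n+m b a) a+b<n
      a<n : a < n
      a<n = <-trans a<b b<n
      0<n : 0 < n
      0<n = <-trans 0<a a<n

      hexagon-vertices : Vec V 6
      hexagon-vertices = plus 0 0<n ∷ minus b b<n ∷ plus b b<n ∷ minus (a + b) a+b<n ∷ plus a a<n ∷ minus a a<n ∷ []

      0≢b : 0 ≢ b
      0≢b = <⇒≢ (<-trans 0<a a<b)
      0≢a : 0 ≢ a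
      0≢a = <⇒≢ 0<a
      b≢a : b ≢ a
      b≢a = >⇒≢ a<b
      b≢a+b : b ≢ a + b
      b≢a+b = <⇒≢ (m<n+m b 0<a)
      a+b≢a : a + b ≢ a
      a+b≢a = >⇒≢ (m<m+n a (<-trans 0<a a<b))

      distinct : Unique hexagon-vertices
      distinct =
          ((λ ()) ∷ (0≢b ∘ plus-injective) ∷ (λ ()) ∷ (0≢a ∘ plus-injective) ∷ (λ ()) ∷ [])
        ∷ ((λ ()) ∷ (b≢a+b ∘ minus-injective) ∷ (λ ()) ∷ (b≢a ∘ minus-injective) ∷ [])
        ∷ ((λ ()) ∷ (b≢a ∘ plus-injective) ∷ (λ ()) ∷ [])
        ∷ ((λ ()) ∷ (a+b≢a ∘ minus-injective) ∷ [])
        ∷ ((λ ()) ∷ [])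
        ∷ []
        ∷ []

      path : ∀ (i : Fin 5) → Adj (lookup hexagon-vertices (inject₁ i)) (lookup hexagon-vertices (fsuc i))
      path fzero = edge b∈S refl 0<n b<n
      path (fsuc fzero) = edge 0∈S (+-identityʳ b) b<n b<n
      path (fsuc (fsuc fzero)) = edge a∈S (+-comm b a) b<n a+b<n
      path (fsuc (fsuc (fsuc fzero))) = edge b∈S refl a<n a+b<n
      path (fsuc (fsuc (fsuc (fsuc fzero)))) = edge 0∈S (+-identityʳ a) a<n a<n

      close : Adj (lookup hexagon-vertices (fromℕ 5)) (lookup hexagon-vertices fzero)
      close = edge a∈S refl 0<n a<n

  girth-six : ∀ {a b} → 0 ∈ S → a ∈ S → b ∈ S → 0 < a → a < b → Sidon S → SumsBelow n S →
              HasGirth (H n S) 6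
  girth-six 0∈S a∈S b∈S 0<a a<b sidon small =
    hexagon 0∈S a∈S b∈S 0<a a<b (lookup² small a∈S b∈S) , no-short-cycle
    where
      no-short-cycle : ∀ k → k < 6 → ¬ CycleOfLength (H n S) k
      no-short-cycle 0 _ ()
      no-short-cycle 1 _ (() , _)
      no-short-cycle 2 _ (s≤s () , _)
      no-short-cycle 3 _ = no-3-cycle
      no-short-cycle 4 _ = no-4-cycle sidon small
      no-short-cycle 5 _ = no-5-cycle
      no-short-cycle (suc (suc (suc (suc (suc (suc _)))))) (s≤s (s≤s (s≤s (s≤s (s≤s (s≤s ()))))))

  common-neighbour : ∀ {x y k k′} → k ∈ S → k′ ∈ S → x + k ≡ y + k′ →
                     .(x<n : x < n) .(y<n : y < n) → .(x + k < n) → Walk (plus x x<n) (plus y y<n)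
  common-neighbour {x} {k = k} k∈S k′∈S e x<n y<n sum<n =
    step {w = minus (x + k) sum<n} refl (edge k∈S refl x<n sum<n) (step refl (edge k′∈S (sym e) y<n sum<n) (here refl))

  -- When 0, d ∈ S, the vertex (q d + r)⁺ is joined to r⁺: each step from
  -- (x + d)⁺ down to x⁺ passes through (x + d)⁻.
  descend : ∀ {d} → 0 ∈ S → d ∈ S → ∀ q r .(r<n : r < n) (bound : q * d + r < n) → Walk (plus (q * d + r) bound) (plus r r<n)
  descend 0∈S d∈S zero r _ _ = here refl
  descend {d} 0∈S d∈S (suc q) r r<n bound =
    common-neighbour 0∈S d∈S (one-step-down d (q * d) r) bound lower (subst (_< n) (sym (+-identityʳ _)) bound)
      ++ descend 0∈S d∈S q r r<n lower
    where
      lower : q * d + r < n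
      lower = ≤-<-trans (+-monoˡ-≤ r (m≤n+m (q * d) d)) bound

  plus-label : ∀ (i : Fin n) {x} → toℕ i ≡ x → .(x<n : x < n) → inj₁ i ≡ plus x x<n
  plus-label i refl _ = cong inj₁ (sym (fromℕ<-toℕ i _))

  -- If 0, d ∈ S with d > 0 and each r⁺ with r < d is joined to 0⁺, then
  -- H(n,S) is connected: every i⁺ descends to (i mod d)⁺, and i⁻ ~ i⁺.
  connected-by-steps : ∀ {d} .{{_ : NonZero d}} → 0 ∈ S → d ∈ S → (0<n : 0 < n) →
    (∀ r → r < d → (r<n : r < n) → Walk (plus r r<n) (plus 0 0<n)) → Connected (H n S)
  connected-by-steps {d} 0∈S d∈S 0<n base u v = to-origin u ++ reverse (to-origin v)
    where
      to-origin : ∀ u → Walk u (plus 0 0<n)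
      to-origin (inj₁ i) =
        subst (λ w → Walk w (plus r r<n)) (sym (plus-label i decomposition decomposed<n)) (descend 0∈S d∈S (toℕ i / d) r r<n decomposed<n)
          ++ base r (m%n<n (toℕ i) d) r<n
        where
          r = toℕ i % d
          decomposition : toℕ i ≡ toℕ i / d * d + r
          decomposition = trans (m≡m%n+[m/n]*n (toℕ i) d) (+-comm r _)
          decomposed<n : toℕ i / d * d + r < n
          decomposed<n = subst (_< n) decomposition (toℕ<n i)
          r<n : r < n
          r<n = ≤-<-trans (m≤n+m r _) decomposed<n
      to-origin (inj₂ j) = step refl (0 , 0∈S , 0 , refl) (to-origin (inj₁ j))

  walk-start : ∀ {ok u v} → WalkIn (H n S) ok u v → ok u ≡ true
  walk-start (here o) = o
  walk-start (step o _ _) = o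

  module Splitting {N} (N≤n : N ≤ n) (cert : SplitCertificate) (valid : ValidCertificate S N cert) where
    open SplitCertificate cert
    open ValidCertificate valid

    in-Σ in-C : V → Bool
    in-Σ (inj₁ i) = does (toℕ i ∈? Σ⁺)
    in-Σ (inj₂ i) = does (toℕ i ∈? Σ⁻)
    in-C (inj₁ i) = does (toℕ i ∈? C⁺)
    in-C (inj₂ i) = does (toℕ i ∈? C⁻)

    below : ∀ {x} → x < N → x < n
    below x<N = <-≤-trans x<N N≤n

    plus-pair-separated : ∀ {i j l : Fin n} → toℕ i ∈ Σ⁺ → toℕ j ∈ Σ⁺ →
                          HaarEdge n S i l → HaarEdge n S j l → i ≡ j
    plus-pair-separated {i} {j} i∈Σ⁺ j∈Σ⁺ (k₁ , k₁∈S , q₁ , e₁) (k₂ , k₂∈S , q₂ , e₂) =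
      toℕ-injective (proj₂ i-side (≈-below common (below (proj₁ i-side)) (below (proj₁ j-side))))
      where
        i-side = lookup² (lookup² plus-separated i∈Σ⁺ j∈Σ⁺) k₁∈S k₂∈S
        j-side = lookup² (lookup² plus-separated j∈Σ⁺ i∈Σ⁺) k₂∈S k₁∈S
        common : toℕ i + k₁ ≈ toℕ j + k₂
        common = ≈-trans (≈-from-edge q₁ e₁) (≈-sym (≈-from-edge q₂ e₂))

    minus-pair-separated : ∀ {i j l : Fin n} → toℕ i ∈ Σ⁻ → toℕ j ∈ Σ⁻ →
                           HaarEdge n S l i → HaarEdge n S l j → i ≡ j
    minus-pair-separated {i} {j} {l} i∈Σ⁻ j∈Σ⁻ (k₁ , k₁∈S , q₁ , e₁) (k₂ , k₂∈S , q₂ , e₂) =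
      toℕ-injective (proj₂ i-side (≈-exact common (widen (proj₁ i-side)) (widen (proj₁ j-side))))
      where
        i-side = lookup² (lookup² minus-separated i∈Σ⁻ j∈Σ⁻) k₁∈S k₂∈S
        j-side = lookup² (lookup² minus-separated j∈Σ⁻ i∈Σ⁻) k₂∈S k₁∈S
        widen : ∀ {x y} → x < y + N → x < y + n
        widen x<y+N = <-≤-trans x<y+N (+-monoʳ-≤ _ N≤n)
        -- i + k₂ ≈ l + k₁ + k₂ ≈ j + k₁
        common : toℕ i + k₂ ≈ toℕ j + k₁
        common = ≈-trans (≈-+ (≈-sym (≈-from-edge q₁ e₁)) (≈-refl {k₂}))
                   (subst (_≈ toℕ j + k₁) (sym (xy∙z≈xz∙y (toℕ l) k₁ k₂)) (≈-+ (≈-from-edge q₂ e₂) ≈-refl))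

    cross-pair-separated : ∀ {i j : Fin n} → toℕ i ∈ Σ⁺ → toℕ j ∈ Σ⁻ → ¬ HaarEdge n S i j
    cross-pair-separated i∈Σ⁺ j∈Σ⁻ (k , k∈S , q , e) =
      let (i+k<N , j<N , i+k≢j) = All.lookup (lookup² cross-separated i∈Σ⁺ j∈Σ⁻) k∈S
      in i+k≢j (≈-below (≈-from-edge q e) (below i+k<N) (below j<N))

    -- Σ is independent in G²: vertices on the same side have no common
    -- neighbour, vertices on opposite sides are not adjacent, and two
    -- vertices at distance 2 lie on the same side.
    independent : IndependentIn² (H n S) in-Σ
    independent (inj₁ i) (inj₁ j) i∈ j∈ (i≢j , inj₂ (inj₂ l , il , lj)) =
      i≢j (cong inj₁ (plus-pair-separated (does-true (toℕ i ∈? Σ⁺) i∈) (does-true (toℕ j ∈? Σ⁺) j∈) il lj))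
    independent (inj₂ i) (inj₂ j) i∈ j∈ (i≢j , inj₂ (inj₁ l , il , lj)) =
      i≢j (cong inj₂ (minus-pair-separated (does-true (toℕ i ∈? Σ⁻) i∈) (does-true (toℕ j ∈? Σ⁻) j∈) il lj))
    independent (inj₁ i) (inj₂ j) i∈ j∈ (_ , inj₁ ij) =
      cross-pair-separated (does-true (toℕ i ∈? Σ⁺) i∈) (does-true (toℕ j ∈? Σ⁻) j∈) ij
    independent (inj₂ j) (inj₁ i) j∈ i∈ (_ , inj₁ ji) =
      cross-pair-separated (does-true (toℕ i ∈? Σ⁺) i∈) (does-true (toℕ j ∈? Σ⁻) j∈) ji
    independent (inj₁ _) (inj₁ _) _ _ (_ , inj₁ ())
    independent (inj₁ _) (inj₁ _) _ _ (_ , inj₂ (inj₁ _ , () , _))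
    independent (inj₂ _) (inj₂ _) _ _ (_ , inj₁ ())
    independent (inj₂ _) (inj₂ _) _ _ (_ , inj₂ (inj₂ _ , () , _))
    independent (inj₁ _) (inj₂ _) _ _ (_ , inj₂ (inj₁ _ , () , _))
    independent (inj₁ _) (inj₂ _) _ _ (_ , inj₂ (inj₂ _ , _ , ()))
    independent (inj₂ _) (inj₁ _) _ _ (_ , inj₂ (inj₁ _ , _ , ()))
    independent (inj₂ _) (inj₁ _) _ _ (_ , inj₂ (inj₂ _ , () , _))

    closed-step : ∀ {u w} → Adj u w → in-C u ≡ true → in-C w ≡ true ⊎ in-Σ w ≡ true
    closed-step {inj₁ i} {inj₂ j} (k , k∈S , q , e) i∈C⁺
      with All.lookup (All.lookup plus-closed (does-true (toℕ i ∈? C⁺) i∈C⁺)) k∈S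
    ... | i+k<N , lands = map-⊎ (dec-true (toℕ j ∈? C⁻) ∘ subst (_∈ C⁻) i+k≡j) (dec-true (toℕ j ∈? Σ⁻) ∘ subst (_∈ Σ⁻) i+k≡j) lands
      where
        i+k≡j : toℕ i + k ≡ toℕ j
        i+k≡j = ≈-below (≈-from-edge q e) (below i+k<N) (toℕ<n j)
    closed-step {inj₂ j} {inj₁ i} (k , k∈S , q , e) j∈C⁻
      with All.lookup (All.lookup minus-closed (does-true (toℕ j ∈? C⁻) j∈C⁻)) k∈S
    ... | k≤j , j<N , lands = map-⊎ (dec-true (toℕ i ∈? C⁺) ∘ subst (_∈ C⁺) j-k≡i) (dec-true (toℕ i ∈? Σ⁺) ∘ subst (_∈ Σ⁺) j-k≡i) lands
      where
        i+k≡j : toℕ i + k ≡ toℕ j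
        i+k≡j = ≈-exact (≈-from-edge q e)
                  (<-≤-trans (+-monoˡ-< k (toℕ<n i)) (subst (_≤ toℕ j + n) (+-comm k n) (+-monoˡ-≤ n k≤j)))
                  (<-≤-trans (below j<N) (m≤n+m n _))
        j-k≡i : toℕ j ∸ k ≡ toℕ i
        j-k≡i = trans (cong (_∸ k) (sym i+k≡j)) (m+n∸n≡m (toℕ i) k)

    stays-in-C : ∀ {u v} → WalkIn (H n S) (not ∘ in-Σ) u v → in-C u ≡ true → in-C v ≡ true
    stays-in-C (here _) u∈C = u∈C
    stays-in-C (step _ a walk) u∈C with closed-step a u∈C
    ... | inj₁ w∈C = stays-in-C walk w∈C
    ... | inj₂ w∈Σ = ⊥-elim (not-true w∈Σ (walk-start walk))
      where
        not-true : ∀ {b} → b ≡ true → not b ≢ true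
        not-true refl ()

    disconnected : DisconnectedAfterRemoving (H n S) in-Σ
    disconnected = plus inside inside<n , plus outside outside<n ,
      dec-false (toℕ (fromℕ< inside<n) ∈? Σ⁺) (inside∉Σ⁺ ∘ subst (_∈ Σ⁺) (toℕ-fromℕ< inside<n)) ,
      dec-false (toℕ (fromℕ< outside<n) ∈? Σ⁺) (outside∉Σ⁺ ∘ subst (_∈ Σ⁺) (toℕ-fromℕ< outside<n)) ,
      λ walk → outside∉C⁺ (subst (_∈ C⁺) (toℕ-fromℕ< outside<n) (does-true (toℕ (fromℕ< outside<n) ∈? C⁺) (stays-in-C walk inside∈C)))
      where
        inside<n = below inside<N
        outside<n = below outside<N
        inside∈C : in-C (plus inside inside<n) ≡ true
        inside∈C = dec-true (toℕ (fromℕ< inside<n) ∈? C⁺) (subst (_∈ C⁺) (sym (toℕ-fromℕ< inside<n)) inside∈C⁺)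

  splittable-by-certificate : ∀ {N} → N ≤ n → (cert : SplitCertificate) → ValidCertificate S N cert →
                              Connected (H n S) → Splittable (H n S)
  splittable-by-certificate N≤n cert valid connected = connected , in-Σ , independent , disconnected
    where open Splitting N≤n cert valid

  connected-0-1 : 0 ∈ S → 1 ∈ S → 0 < n → Connected (H n S)
  connected-0-1 0∈S 1∈S 0<n = connected-by-steps {d = 1} 0∈S 1∈S 0<n base
    where
      base : ∀ r → r < 1 → (r<n : r < n) → Walk (plus r r<n) (plus 0 0<n)
      base 0 _ _ = here refl
      base (suc _) (s≤s ()) _

  -- With 0, 2, 5 ∈ S, every i⁺ descends to 0⁺ or 1⁺, and 1⁺ is joined to
  -- 0⁺ through 3⁺, using 1 + 2 = 3 + 0 and 3 + 2 = 0 + 5.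
  connected-0-2-5 : 0 ∈ S → 2 ∈ S → 5 ∈ S → 5 < n → Connected (H n S)
  connected-0-2-5 0∈S 2∈S 5∈S 5<n = connected-by-steps {d = 2} 0∈S 2∈S 0<n base
    where
      0<n : 0 < n
      0<n = ≤-<-trans z≤n 5<n
      3<n : 3 < n
      3<n = ≤-<-trans (s≤s (s≤s (s≤s z≤n))) 5<n
      base : ∀ r → r < 2 → (r<n : r < n) → Walk (plus r r<n) (plus 0 0<n)
      base 0 _ _ = here refl
      base 1 _ 1<n = reverse (common-neighbour 0∈S 2∈S refl 3<n 1<n 3<n)
                     ++ common-neighbour 2∈S 5∈S refl 3<n 0<n 5<n
      base (suc (suc _)) (s≤s (s≤s ())) _

girth-six-and-splittable : ∀ {S N a b} → 0 ∈ S → a ∈ S → b ∈ S → 0 < a → a < b →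
  Sidon S → SumsBelow N S → (cert : SplitCertificate) → ValidCertificate S N cert →
  (∀ n → N ≤ n → Connected (H n S)) → ∀ n → N ≤ n → HasGirth (H n S) 6 × Splittable (H n S)
girth-six-and-splittable {S} 0∈S a∈S b∈S 0<a a<b sidon small cert valid connected n N≤n =
  girth-six 0∈S a∈S b∈S 0<a a<b sidon (sums-below-mono N≤n small) ,
  splittable-by-certificate N≤n cert valid (connected n N≤n)
  where open HaarGraph n S

-- Explicit certificates for the three difference sets; their validity is
-- established by running valid? in the proof of corollary8.
certificate-0-1-4 certificate-0-1-5 certificate-0-2-5 : SplitCertificate
certificate-0-1-4 = certificate (3 ∷ 4 ∷ 7 ∷ []) (4 ∷ 7 ∷ 8 ∷ []) (0 ∷ 6 ∷ 8 ∷ []) (3 ∷ 5 ∷ 11 ∷ []) 3 1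
certificate-0-1-5 = certificate (4 ∷ 5 ∷ 9 ∷ []) (5 ∷ 9 ∷ 10 ∷ []) (0 ∷ 8 ∷ 10 ∷ []) (4 ∷ 6 ∷ 14 ∷ []) 4 1
certificate-0-2-5 = certificate (3 ∷ 5 ∷ 8 ∷ []) (5 ∷ 8 ∷ 10 ∷ []) (0 ∷ 6 ∷ 10 ∷ []) (3 ∷ 7 ∷ 13 ∷ []) 3 1

corollary8 : (∀ (n : ℕ) → 13 ≤ n → HasGirth (H n (0 ∷ 1 ∷ 4 ∷ [])) 6 × Splittable (H n (0 ∷ 1 ∷ 4 ∷ [])))
    × (∀ (n : ℕ) → 16 ≤ n → HasGirth (H n (0 ∷ 1 ∷ 5 ∷ [])) 6 × Splittable (H n (0 ∷ 1 ∷ 5 ∷ [])))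
    × (∀ (n : ℕ) → 16 ≤ n → HasGirth (H n (0 ∷ 2 ∷ 5 ∷ [])) 6 × Splittable (H n (0 ∷ 2 ∷ 5 ∷ [])))
corollary8 =
    girth-six-and-splittable 0∈ 1∈ 4∈ z<s (s<s z<s) (from-yes (sidon? S₁)) (from-yes (sums-below? 13 S₁))
      certificate-0-1-4 (from-yes (valid? S₁ 13 certificate-0-1-4))
      (λ n 13≤n → HaarGraph.connected-0-1 n S₁ 0∈ 1∈ (<-≤-trans z<s 13≤n))
  , girth-six-and-splittable 0∈ 1∈ 5∈ z<s (s<s z<s) (from-yes (sidon? S₂)) (from-yes (sums-below? 16 S₂))
      certificate-0-1-5 (from-yes (valid? S₂ 16 certificate-0-1-5))
      (λ n 16≤n → HaarGraph.connected-0-1 n S₂ 0∈ 1∈ (<-≤-trans z<s 16≤n))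
  , girth-six-and-splittable 0∈ 2∈ 5∈ z<s (s<s (s<s z<s)) (from-yes (sidon? S₃)) (from-yes (sums-below? 16 S₃))
      certificate-0-2-5 (from-yes (valid? S₃ 16 certificate-0-2-5))
      (λ n 16≤n → HaarGraph.connected-0-2-5 n S₃ 0∈ 2∈ 5∈ (<-≤-trans (from-yes (5 <? 16)) 16≤n))
  where
    S₁ S₂ S₃ : List ℕ
    S₁ = 0 ∷ 1 ∷ 4 ∷ []
    S₂ = 0 ∷ 1 ∷ 5 ∷ []
    S₃ = 0 ∷ 2 ∷ 5 ∷ []
    0∈ : ∀ {a b} → 0 ∈ 0 ∷ a ∷ b ∷ []
    0∈ = here refl
    1∈ : ∀ {b} → 1 ∈ 0 ∷ 1 ∷ b ∷ []
    1∈ = there (here refl)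
    2∈ : ∀ {b} → 2 ∈ 0 ∷ 2 ∷ b ∷ []
    2∈ = there (here refl)
    4∈ : 4 ∈ S₁
    4∈ = there (there (here refl))
    5∈ : ∀ {a} → 5 ∈ 0 ∷ a ∷ 5 ∷ []
    5∈ = there (there (here refl))
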